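{- Let $D$ be a digraph, let $X\subseteq V(D)$, let $y\in V(D)\setminus X$, and let $\mathcal{P}$ and $\mathcal{Q}$ be $(X,y)$-path-systems in $D$. Then there is an $(X,y)$-path-system $\mathcal{R}$ in $D$ with $V^-(\mathcal{R})\supseteq V^-(\mathcal{P})$ and $E^+(\mathcal{R})\supseteq E^+(\mathcal{Q})$.
   Context: An $(X,y)$-path is a directed path whose initial vertex is in $X$, whose terminal vertex is $y$, and which is internally disjoint from $X$. An $(X,y)$-path-system is a set of $(X,y)$-paths that are pairwise disjoint except at $y$. For a set of paths $\mathcal{P}$, $V^-(\mathcal{P})$ is the set of initial vertices and $E^+(\mathcal{P})$ the set of terminal (last) edges of the paths in $\mathcal{P}$. -}

module Defs where

open import Data.Nat using (ℕ)
open import Data.Fin using (Fin)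
open import Data.Fin.Subset using (Subset; _∈_; _∉_)
open import Data.List using (List; []; _∷_)
open import Data.List.Relation.Unary.All using (All)
open import Data.List.Relation.Unary.Unique.Propositional using (Unique)
open import Data.List.Relation.Unary.AllPairs using (AllPairs)
import Data.List.Membership.Propositional as LM
open import Data.Maybe using (Maybe; just; nothing)
open import Relation.Binary.PropositionalEquality using (_≡_)

-- A finite digraph (parallel edges and loops allowed): vertices Fin n,
-- edges Fin m, each edge e goes from tail e to head e.
record Digraph : Set where
  field
    n    : ℕ
    m    : ℕ
    tail : Fin m → Fin n
    head : Fin m → Fin n

module _ (D : Digraph) where
  open Digraph D

  Vertex : Set
  Vertex = Fin n

  Edge : Set
  Edge = Fin m

  data Walk : Vertex → Vertex → Set where
    []  : ∀ {v} → Walk v v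
    cons : ∀ {u w} (e : Edge) → tail e ≡ u → Walk (head e) w → Walk u w

  vertices : ∀ {u v} → Walk u v → List Vertex
  vertices {v = v} [] = v ∷ []
  vertices {u = u} (cons e _ w) = u ∷ vertices w

  interior : ∀ {u v} → Walk u v → List Vertex
  interior [] = []
  interior (cons e _ []) = []
  interior (cons e _ (cons f p w)) = head e ∷ interior (cons f p w)

  lastEdge : ∀ {u v} → Walk u v → Maybe Edge
  lastEdge [] = nothing
  lastEdge (cons e _ []) = just e
  lastEdge (cons e _ (cons f p w)) = lastEdge (cons f p w)

  IsPath : ∀ {u v} → Walk u v → Set
  IsPath w = Unique (vertices w)

  record XYPath (X : Subset n) (y : Vertex) : Set where
    constructor xypath
    field
      start    : Vertex
      start∈X  : start ∈ X
      walk     : Walk start y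
      isPath   : IsPath walk
      internal : All (λ v → v ∉ X) (interior walk)

  open XYPath public

  pathVertices : ∀ {X y} → XYPath X y → List Vertex
  pathVertices P = vertices (walk P)

  DisjointExcept : ∀ {X y} → XYPath X y → XYPath X y → Set
  DisjointExcept {y = y} P Q =
    ∀ v → v LM.∈ pathVertices P → v LM.∈ pathVertices Q → v ≡ y

  record PathSystem (X : Subset n) (y : Vertex) : Set where
    constructor pathSystem
    field
      paths    : List (XYPath X y)
      disjoint : AllPairs DisjointExcept paths

  open PathSystem public

  _∈V⁻_ : ∀ {X y} → Vertex → PathSystem X y → Set
  v ∈V⁻ 𝒫 = LM._∈_ v (Data.List.map start (paths 𝒫))
    where import Data.List

  _∈E⁺_ : ∀ {X y} → Edge → PathSystem X y → Set
  e ∈E⁺ 𝒫 = LM._∈_ (just e) (Data.List.map (λ P → lastEdge (walk P)) (paths 𝒫))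
    where import Data.List

module Submission where

-- Given (X,y)-path-systems 𝒫 and 𝒬 we transform 𝒬 step by step, keeping two
-- invariants: the current family 𝒮 is an (X,y)-path-system, and every last
-- edge of a 𝒬-path is the last edge of some 𝒮-path.  While some P ∈ 𝒫 has
-- its start off 𝒮, follow P to the first vertex z ≠ y lying on 𝒮.
--   * If there is no such z, P meets 𝒮 only in y, and we add P to 𝒮.
--   * Otherwise z lies on some Q ∈ 𝒮, and we replace Q by the path R that
--     follows P up to z and then Q from z to y; R has the last edge of Q.
-- Termination: the "excess" of a path is its number of vertices beyond the
-- longest prefix it shares with a 𝒫-path.  Rerouting strictly decreases the
-- total excess of 𝒮, adding P keeps it and covers one more 𝒫-start.  When
-- all 𝒫-starts lie on 𝒮 they are 𝒮-starts, since an (X,y)-path meets X only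
-- in its start.

open import Defs
open import Data.Product using (Σ; _×_; _,_; proj₁; proj₂)
open import Data.Sum using (_⊎_; inj₁; inj₂)
open import Data.Empty using (⊥; ⊥-elim)
open import Data.Nat using (ℕ; zero; suc; _+_; _*_; _∸_; _⊔_; _≤_; _<_; s≤s; z≤n)
open import Data.Nat.Properties
  using (≤-refl; ≤-trans; ≤-pred; <-≤-trans; m≤m⊔n; m≤n⊔m; ⊔-lub; m∸n≤m; m≤n+m; m≤m+n;
         +-comm; +-∸-comm; +-monoˡ-<; +-monoʳ-<; *-monoˡ-≤; m≤n⇒m≤1+n; m≤n⇒m∸n≡0; ≤-reflexive)
open import Data.Nat.ListAction using (sum)
open import Data.Fin using (_≟_)
open import Data.Fin.Subset using (Subset; _∉_)
import Data.Fin.Subset as Subset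
open import Data.List using (List; []; _∷_; _++_; length; map)
open import Data.List.Properties using (length-++; ∷-injectiveˡ)
open import Data.List.Relation.Unary.Any using (Any; here; there; any?)
open import Data.List.Relation.Unary.All as All using (All; []; _∷_)
import Data.List.Relation.Unary.All.Properties as All
open import Data.List.Relation.Unary.AllPairs using (AllPairs; []; _∷_)
open import Data.List.Relation.Unary.Unique.Propositional using (Unique)
import Data.List.Relation.Unary.Unique.Propositional.Properties as Unique
open import Data.List.Membership.Propositional using (_∈_; find; lose)
open import Data.List.Membership.Propositional.Properties using (∈-++⁺ʳ; ∈-++⁻; ∈-map⁺; ∈-map⁻)
import Data.List.Membership.DecPropositional as DecMembership
open import Data.Maybe using (Maybe; just)
open import Relation.Nullary using (¬_; Dec; yes; no)
open import Relation.Nullary.Decidable using (¬?; _×-dec_)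
open import Relation.Binary.Definitions using (DecidableEquality)
open import Relation.Binary.PropositionalEquality using (_≡_; refl; sym; trans; cong; subst)

module _ {A : Set} where

  Unique-++-disjoint : ∀ xs {ys : List A} {v} → Unique (xs ++ ys) → v ∈ xs → v ∈ ys → ⊥
  Unique-++-disjoint (x ∷ xs) (x∉ ∷ _) (here refl) v∈ys = All.lookup x∉ (∈-++⁺ʳ xs v∈ys) refl
  Unique-++-disjoint (x ∷ xs) (_ ∷ u) (there v∈xs) v∈ys = Unique-++-disjoint xs u v∈xs v∈ys

  Unique-++⁻ˡ : ∀ xs {ys : List A} → Unique (xs ++ ys) → Unique xs
  Unique-++⁻ˡ [] u = []
  Unique-++⁻ˡ (x ∷ xs) (x∉ ∷ u) = All.++⁻ˡ xs x∉ ∷ Unique-++⁻ˡ xs u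

  Unique-++⁻ʳ : ∀ xs {ys : List A} → Unique (xs ++ ys) → Unique ys
  Unique-++⁻ʳ [] u = u
  Unique-++⁻ʳ (x ∷ xs) (_ ∷ u) = Unique-++⁻ʳ xs u

  AllPairs-lookup : ∀ {R : A → A → Set} {xs a b} → AllPairs R xs → a ∈ xs → b ∈ xs →
    a ≡ b ⊎ R a b ⊎ R b a
  AllPairs-lookup (_ ∷ _) (here refl) (here refl) = inj₁ refl
  AllPairs-lookup (r ∷ _) (here refl) (there b∈) = inj₂ (inj₁ (All.lookup r b∈))
  AllPairs-lookup (r ∷ _) (there a∈) (here refl) = inj₂ (inj₂ (All.lookup r a∈))
  AllPairs-lookup (_ ∷ rs) (there a∈) (there b∈) = AllPairs-lookup rs a∈ b∈

  replace : ∀ {a} xs → a ∈ xs → A → List A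
  replace (x ∷ xs) (here _) r = r ∷ xs
  replace (x ∷ xs) (there a∈) r = x ∷ replace xs a∈ r

  All-replace : ∀ {P : A → Set} {a r xs} → All P xs → (a∈ : a ∈ xs) → P r → All P (replace xs a∈ r)
  All-replace (_ ∷ ps) (here _) pr = pr ∷ ps
  All-replace (p ∷ ps) (there a∈) pr = p ∷ All-replace ps a∈ pr

  AllPairs-replace : ∀ {R : A → A → Set} {a r xs} → AllPairs R xs → (a∈ : a ∈ xs) →
    (∀ {z} → z ∈ xs → R a z → R r z) → (∀ {z} → z ∈ xs → R z a → R z r) →
    AllPairs R (replace xs a∈ r)
  AllPairs-replace (ra ∷ rs) (here refl) right left =
    All.tabulate (λ z∈ → right (there z∈) (All.lookup ra z∈)) ∷ rs
  AllPairs-replace (rx ∷ rs) (there a∈) right left =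
    All-replace rx a∈ (left (here refl) (All.lookup rx a∈))
      ∷ AllPairs-replace rs a∈ (λ z∈ → right (there z∈)) (λ z∈ → left (there z∈))

  map-replace : ∀ {B : Set} (f : A → B) {a r xs} (a∈ : a ∈ xs) → f r ≡ f a →
    map f (replace xs a∈ r) ≡ map f xs
  map-replace f {xs = _ ∷ xs} (here refl) eq = cong (_∷ map f xs) eq
  map-replace f {xs = x ∷ _} (there a∈) eq = cong (f x ∷_) (map-replace f a∈ eq)

  sum-replace-< : ∀ (f : A → ℕ) {a r} xs (a∈ : a ∈ xs) → f r < f a →
    sum (map f (replace xs a∈ r)) < sum (map f xs)
  sum-replace-< f (_ ∷ xs) (here refl) lt = +-monoˡ-< (sum (map f xs)) lt
  sum-replace-< f (x ∷ xs) (there a∈) lt = +-monoʳ-< (f x) (sum-replace-< f xs a∈ lt)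

module CommonPrefix {A : Set} (_≟ᴬ_ : DecidableEquality A) where

  commonPrefix : List A → List A → ℕ
  commonPrefix [] _ = 0
  commonPrefix (_ ∷ _) [] = 0
  commonPrefix (a ∷ as) (b ∷ bs) with a ≟ᴬ b
  ... | yes _ = suc (commonPrefix as bs)
  ... | no _ = 0

  commonPrefix-refl : ∀ xs → length xs ≤ commonPrefix xs xs
  commonPrefix-refl [] = z≤n
  commonPrefix-refl (x ∷ xs) with x ≟ᴬ x
  ... | yes _ = s≤s (commonPrefix-refl xs)
  ... | no x≢x = ⊥-elim (x≢x refl)

  commonPrefix-++ : ∀ xs z ys zs → suc (length xs) ≤ commonPrefix (xs ++ z ∷ ys) (xs ++ z ∷ zs)
  commonPrefix-++ [] z ys zs with z ≟ᴬ z
  ... | yes _ = s≤s z≤n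
  ... | no z≢z = ⊥-elim (z≢z refl)
  commonPrefix-++ (x ∷ xs) z ys zs with x ≟ᴬ x
  ... | yes _ = s≤s (commonPrefix-++ xs z ys zs)
  ... | no x≢x = ⊥-elim (x≢x refl)

  commonPrefix-≤-or-extends : ∀ xs z ys ws →
    commonPrefix (xs ++ z ∷ ys) ws ≤ length xs ⊎ Σ (List A) (λ ws′ → ws ≡ xs ++ z ∷ ws′)
  commonPrefix-≤-or-extends [] z ys [] = inj₁ z≤n
  commonPrefix-≤-or-extends [] z ys (w ∷ ws) with z ≟ᴬ w
  ... | yes refl = inj₂ (ws , refl)
  ... | no _ = inj₁ z≤n
  commonPrefix-≤-or-extends (x ∷ xs) z ys [] = inj₁ z≤n
  commonPrefix-≤-or-extends (x ∷ xs) z ys (w ∷ ws) with x ≟ᴬ w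
  ... | no _ = inj₁ z≤n
  ... | yes refl with commonPrefix-≤-or-extends xs z ys ws
  ...   | inj₁ le = inj₁ (s≤s le)
  ...   | inj₂ (ws′ , refl) = inj₂ (ws′ , refl)

module Walks (D : Digraph) where
  open Digraph D using (tail; head)

  infixr 5 _++ʷ_
  _++ʷ_ : ∀ {u v w} → Walk D u v → Walk D v w → Walk D u w
  [] ++ʷ q = q
  cons e p w ++ʷ q = cons e p (w ++ʷ q)

  initVertices : ∀ {u v} → Walk D u v → List (Vertex D)
  initVertices [] = []
  initVertices {u} (cons e p w) = u ∷ initVertices w

  vertices-++ : ∀ {u v w} (p : Walk D u v) (q : Walk D v w) →
    vertices D (p ++ʷ q) ≡ initVertices p ++ vertices D q
  vertices-++ [] q = refl
  vertices-++ {u} (cons e p w) q = cong (u ∷_) (vertices-++ w q)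

  vertices-head : ∀ {u v} (w : Walk D u v) → Σ (List (Vertex D)) λ r → vertices D w ≡ u ∷ r
  vertices-head [] = _ , refl
  vertices-head (cons e p w) = _ , refl

  start∈vertices : ∀ {u v} (w : Walk D u v) → u ∈ vertices D w
  start∈vertices [] = here refl
  start∈vertices (cons e p w) = here refl

  end∈vertices : ∀ {u v} (w : Walk D u v) → v ∈ vertices D w
  end∈vertices [] = here refl
  end∈vertices (cons e p w) = there (end∈vertices w)

  data NonEmpty : ∀ {u v} → Walk D u v → Set where
    nonEmpty : ∀ {u w e} {p : tail e ≡ u} {r : Walk D (head e) w} → NonEmpty (cons e p r)

  distinct⇒NonEmpty : ∀ {u v} (w : Walk D u v) → ¬ (u ≡ v) → NonEmpty w
  distinct⇒NonEmpty [] u≢u = ⊥-elim (u≢u refl)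
  distinct⇒NonEmpty (cons e p w) _ = nonEmpty

  ++-NonEmpty : ∀ {u v w} (p : Walk D u v) {q : Walk D v w} → NonEmpty q → NonEmpty (p ++ʷ q)
  ++-NonEmpty [] ne = ne
  ++-NonEmpty (cons e p w) ne = nonEmpty

  initVertices-head : ∀ {u v} (w : Walk D u v) → NonEmpty w →
    Σ (List (Vertex D)) λ r → initVertices w ≡ u ∷ r
  initVertices-head (cons e p w) nonEmpty = _ , refl

  interior-cons : ∀ {a b x} e (q : tail e ≡ a) (w : Walk D (head e) b) →
    x ∈ interior D w → x ∈ interior D (cons e q w)
  interior-cons e q (cons f p w) x∈ = there x∈

  interior-++ˡ : ∀ {a b c x} (p : Walk D a b) (q : Walk D b c) →
    x ∈ interior D p → x ∈ interior D (p ++ʷ q)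
  interior-++ˡ (cons e _ (cons f p w)) q (here refl) = here refl
  interior-++ˡ (cons e _ (cons f p w)) q (there x∈) = there (interior-++ˡ (cons f p w) q x∈)

  interior-++ʳ : ∀ {a b c x} (p : Walk D a b) (q : Walk D b c) →
    x ∈ interior D q → x ∈ interior D (p ++ʷ q)
  interior-++ʳ [] q x∈ = x∈
  interior-++ʳ (cons e r p) q x∈ = interior-cons e r (p ++ʷ q) (interior-++ʳ p q x∈)

  interior-junction : ∀ {a b c} (p : Walk D a b) (q : Walk D b c) → NonEmpty p → NonEmpty q →
    b ∈ interior D (p ++ʷ q)
  interior-junction (cons e _ []) (cons f p w) nonEmpty nonEmpty = here refl
  interior-junction (cons e _ (cons f p w)) q nonEmpty ne =
    there (interior-junction (cons f p w) q nonEmpty ne)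

  interior-++⁻ : ∀ {a b c x} (p : Walk D a b) (q : Walk D b c) → NonEmpty p → NonEmpty q →
    x ∈ interior D (p ++ʷ q) → x ∈ interior D p ⊎ x ≡ b ⊎ x ∈ interior D q
  interior-++⁻ (cons e _ []) (cons f p w) nonEmpty nonEmpty (here refl) = inj₂ (inj₁ refl)
  interior-++⁻ (cons e _ []) (cons f p w) nonEmpty nonEmpty (there x∈) = inj₂ (inj₂ x∈)
  interior-++⁻ (cons e _ (cons f p w)) q nonEmpty ne (here refl) = inj₁ (here refl)
  interior-++⁻ (cons e _ (cons f p w)) q nonEmpty ne (there x∈)
    with interior-++⁻ (cons f p w) q nonEmpty ne x∈
  ... | inj₁ x∈p = inj₁ (there x∈p)
  ... | inj₂ rest = inj₂ rest

  vertices-classify : ∀ {u v x} (w : Walk D u v) → x ∈ vertices D w →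
    x ≡ u ⊎ x ∈ interior D w ⊎ x ≡ v
  vertices-classify [] (here refl) = inj₁ refl
  vertices-classify (cons e p []) (here refl) = inj₁ refl
  vertices-classify (cons e p []) (there (here refl)) = inj₂ (inj₂ refl)
  vertices-classify (cons e p (cons f q w)) (here refl) = inj₁ refl
  vertices-classify (cons e p (cons f q w)) (there x∈) with vertices-classify (cons f q w) x∈
  ... | inj₁ refl = inj₂ (inj₁ (here refl))
  ... | inj₂ (inj₁ x∈int) = inj₂ (inj₁ (there x∈int))
  ... | inj₂ (inj₂ x≡v) = inj₂ (inj₂ x≡v)

  lastEdge-++ : ∀ {a b c} (p : Walk D a b) (q : Walk D b c) → NonEmpty q →
    lastEdge D (p ++ʷ q) ≡ lastEdge D q
  lastEdge-++ [] q ne = refl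
  lastEdge-++ (cons e r p) q ne with p ++ʷ q | ++-NonEmpty p ne | lastEdge-++ p q ne
  ... | cons f s w | nonEmpty | eq = eq

  splitAt : ∀ {u v z} (w : Walk D u v) → z ∈ vertices D w →
    Σ (Walk D u z) λ p → Σ (Walk D z v) λ q → w ≡ p ++ʷ q
  splitAt [] (here refl) = [] , [] , refl
  splitAt (cons e p w) (here refl) = [] , cons e p w , refl
  splitAt (cons e p w) (there z∈) with splitAt w z∈
  ... | q₁ , q₂ , eq = cons e p q₁ , q₂ , cong (cons e p) eq

  firstHit : ∀ {Pr : Vertex D → Set} → (∀ v → Dec (Pr v)) → ∀ {u v} (w : Walk D u v) →
    (∀ x → x ∈ vertices D w → ¬ Pr x) ⊎
    Σ (Vertex D) λ z → Σ (Walk D u z) λ p → Σ (Walk D z v) λ q →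
      (w ≡ p ++ʷ q) × Pr z × (∀ x → x ∈ initVertices p → ¬ Pr x)
  firstHit Pr? {v = v} [] with Pr? v
  ... | yes pv = inj₂ (v , [] , [] , refl , pv , λ x ())
  ... | no ¬pv = inj₁ λ { x (here refl) → ¬pv }
  firstHit Pr? {u = u} (cons e p w) with Pr? u
  ... | yes pu = inj₂ (u , [] , cons e p w , refl , pu , λ x ())
  ... | no ¬pu with firstHit Pr? w
  ...   | inj₁ none = inj₁ λ { x (here refl) → ¬pu ; x (there x∈) → none x x∈ }
  ...   | inj₂ (z , q₁ , q₂ , eq , pz , before) =
          inj₂ (z , cons e p q₁ , q₂ , cong (cons e p) eq , pz ,
                λ { x (here refl) → ¬pu ; x (there x∈) → before x x∈ })

-- A list of length a + suc b of which c elements are shared has excess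
-- (a + suc b) ∸ c: at most b if c > a, and more than b if c ≤ a.
excess-≤ : ∀ a b c → suc a ≤ c → (a + suc b) ∸ c ≤ b
excess-≤ zero b (suc c) _ = m∸n≤m b c
excess-≤ (suc a) b (suc c) (s≤s le) = excess-≤ a b c le

excess-≥ : ∀ a b c → c ≤ a → suc b ≤ (a + suc b) ∸ c
excess-≥ a b c le rewrite +-∸-comm (suc b) le = m≤n+m (suc b) (a ∸ c)

-- lexicographic order on (s, c) encoded as s * K + c with c < K
lex-< : ∀ s′ s c′ c K → s′ < s → c′ < K → s′ * K + c′ < s * K + c
lex-< s′ s c′ c K s′<s c′<K =
  <-≤-trans (+-monoʳ-< (s′ * K) c′<K)
    (≤-trans (≤-trans (≤-reflexive (+-comm (s′ * K) K)) (*-monoˡ-≤ K s′<s)) (m≤m+n (s * K) c))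

module Augmentation (D : Digraph) (X : Subset (Digraph.n D)) (y : Vertex D) (y∉X : y ∉ X)
                    (𝒫 𝒬 : PathSystem D X y) where
  open Walks D
  open DecMembership (_≟_ {Digraph.n D}) using (_∈?_)
  open CommonPrefix (_≟_ {Digraph.n D})

  Path : Set
  Path = XYPath D X y

  vs : Path → List (Vertex D)
  vs P = vertices D (walk P)

  Disjoint : Path → Path → Set
  Disjoint = DisjointExcept D

  lastEdgeOf : Path → Maybe (Edge D)
  lastEdgeOf P = lastEdge D (walk P)

  X-vertex-is-start : ∀ (Q : Path) {v} → v ∈ vs Q → v Subset.∈ X → v ≡ start Q
  X-vertex-is-start Q v∈ v∈X with vertices-classify (walk Q) v∈
  ... | inj₁ v≡start = v≡start
  ... | inj₂ (inj₁ v∈int) = ⊥-elim (All.lookup (internal Q) v∈int v∈X)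
  ... | inj₂ (inj₂ refl) = ⊥-elim (y∉X v∈X)

  OnSystem : List Path → Vertex D → Set
  OnSystem 𝒮 v = Any (λ Q → v ∈ vs Q) 𝒮

  onSystem? : ∀ 𝒮 v → Dec (OnSystem 𝒮 v)
  onSystem? 𝒮 v = any? (λ Q → v ∈? vs Q) 𝒮

  -- the vertices where a walk along P may switch onto 𝒮
  Junction : List Path → Vertex D → Set
  Junction 𝒮 v = ¬ (v ≡ y) × OnSystem 𝒮 v

  junction? : ∀ 𝒮 v → Dec (Junction 𝒮 v)
  junction? 𝒮 v = ¬? (v ≟ y) ×-dec onSystem? 𝒮 v

  KeepsLastEdges : List Path → Set
  KeepsLastEdges 𝒮 = ∀ e → just e ∈ map lastEdgeOf (paths 𝒬) → just e ∈ map lastEdgeOf 𝒮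

  sharedWith : List (Vertex D) → List Path → ℕ
  sharedWith xs [] = 0
  sharedWith xs (P ∷ Ps) = commonPrefix xs (vs P) ⊔ sharedWith xs Ps

  sharedWith-≥ : ∀ {xs P} Ps → P ∈ Ps → commonPrefix xs (vs P) ≤ sharedWith xs Ps
  sharedWith-≥ (P ∷ Ps) (here refl) = m≤m⊔n _ _
  sharedWith-≥ {xs} (P ∷ Ps) (there P∈) = ≤-trans (sharedWith-≥ Ps P∈) (m≤n⊔m (commonPrefix xs (vs P)) _)

  sharedWith-≤ : ∀ {xs k} Ps → (∀ {P} → P ∈ Ps → commonPrefix xs (vs P) ≤ k) → sharedWith xs Ps ≤ k
  sharedWith-≤ [] bound = z≤n
  sharedWith-≤ (P ∷ Ps) bound = ⊔-lub (bound (here refl)) (sharedWith-≤ Ps (λ P∈ → bound (there P∈)))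

  shared : List (Vertex D) → ℕ
  shared xs = sharedWith xs (paths 𝒫)

  excess : List (Vertex D) → ℕ
  excess xs = length xs ∸ shared xs

  excessOf : Path → ℕ
  excessOf Q = excess (vs Q)

  totalExcess : List Path → ℕ
  totalExcess 𝒮 = sum (map excessOf 𝒮)

  excess-𝒫 : ∀ {P} → P ∈ paths 𝒫 → excessOf P ≡ 0
  excess-𝒫 {P} P∈ = m≤n⇒m∸n≡0 (≤-trans (commonPrefix-refl (vs P)) (sharedWith-≥ {vs P} (paths 𝒫) P∈))

  uncovered : List Path → List Path → ℕ
  uncovered 𝒮 [] = 0
  uncovered 𝒮 (P ∷ Ps) with onSystem? 𝒮 (start P)
  ... | yes _ = uncovered 𝒮 Ps
  ... | no _ = suc (uncovered 𝒮 Ps)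

  uncovered-≤ : ∀ 𝒮 Ps → uncovered 𝒮 Ps ≤ length Ps
  uncovered-≤ 𝒮 [] = z≤n
  uncovered-≤ 𝒮 (P ∷ Ps) with onSystem? 𝒮 (start P)
  ... | yes _ = m≤n⇒m≤1+n (uncovered-≤ 𝒮 Ps)
  ... | no _ = s≤s (uncovered-≤ 𝒮 Ps)

  uncovered-mono : ∀ 𝒮 𝒮′ → (∀ {v} → OnSystem 𝒮 v → OnSystem 𝒮′ v) →
    ∀ Ps → uncovered 𝒮′ Ps ≤ uncovered 𝒮 Ps
  uncovered-mono 𝒮 𝒮′ ⊆ [] = z≤n
  uncovered-mono 𝒮 𝒮′ ⊆ (P ∷ Ps) with onSystem? 𝒮 (start P) | onSystem? 𝒮′ (start P)
  ... | yes _ | yes _ = uncovered-mono 𝒮 𝒮′ ⊆ Ps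
  ... | yes on | no off = ⊥-elim (off (⊆ on))
  ... | no _ | yes _ = m≤n⇒m≤1+n (uncovered-mono 𝒮 𝒮′ ⊆ Ps)
  ... | no _ | no _ = s≤s (uncovered-mono 𝒮 𝒮′ ⊆ Ps)

  uncovered-< : ∀ 𝒮 𝒮′ → (∀ {v} → OnSystem 𝒮 v → OnSystem 𝒮′ v) → ∀ {P} Ps → P ∈ Ps →
    ¬ OnSystem 𝒮 (start P) → OnSystem 𝒮′ (start P) → uncovered 𝒮′ Ps < uncovered 𝒮 Ps
  uncovered-< 𝒮 𝒮′ ⊆ (P ∷ Ps) P∈ off on′ with onSystem? 𝒮 (start P) | onSystem? 𝒮′ (start P) | P∈
  ... | yes on | _ | here refl = ⊥-elim (off on)
  ... | no _ | no off′ | here refl = ⊥-elim (off′ on′)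
  ... | no _ | yes _ | here refl = s≤s (uncovered-mono 𝒮 𝒮′ ⊆ Ps)
  ... | yes _ | yes _ | there P∈′ = uncovered-< 𝒮 𝒮′ ⊆ Ps P∈′ off on′
  ... | yes on | no off′ | there _ = ⊥-elim (off′ (⊆ on))
  ... | no _ | yes _ | there P∈′ = m≤n⇒m≤1+n (uncovered-< 𝒮 𝒮′ ⊆ Ps P∈′ off on′)
  ... | no _ | no _ | there P∈′ = s≤s (uncovered-< 𝒮 𝒮′ ⊆ Ps P∈′ off on′)

  -- uncovered stays below K, so measure compares (totalExcess, uncovered) lexicographically
  K : ℕ
  K = suc (length (paths 𝒫))

  measure : List Path → ℕ
  measure 𝒮 = totalExcess 𝒮 * K + uncovered 𝒮 (paths 𝒫)

  excess-after : ∀ xs z ys → suc (length xs) ≤ shared (xs ++ z ∷ ys) → excess (xs ++ z ∷ ys) ≤ length ys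
  excess-after xs z ys le rewrite length-++ xs {z ∷ ys} = excess-≤ (length xs) (length ys) _ le

  excess-before : ∀ xs z ys → shared (xs ++ z ∷ ys) ≤ length xs → suc (length ys) ≤ excess (xs ++ z ∷ ys)
  excess-before xs z ys le rewrite length-++ xs {z ∷ ys} = excess-≥ (length xs) (length ys) _ le

  measure-add-< : ∀ 𝒮 {P} → P ∈ paths 𝒫 → ¬ OnSystem 𝒮 (start P) → measure (P ∷ 𝒮) < measure 𝒮
  measure-add-< 𝒮 {P} P∈ off rewrite excess-𝒫 P∈ =
    +-monoʳ-< (totalExcess 𝒮 * K)
      (uncovered-< 𝒮 (P ∷ 𝒮) there (paths 𝒫) P∈ off (here (start∈vertices (walk P))))

  measure-replace-< : ∀ 𝒮 {Q R} (Q∈ : Q ∈ 𝒮) → excessOf R < excessOf Q → measure (replace 𝒮 Q∈ R) < measure 𝒮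
  measure-replace-< 𝒮 Q∈ lt =
    lex-< _ _ _ _ K (sum-replace-< excessOf 𝒮 Q∈ lt) (s≤s (uncovered-≤ _ (paths 𝒫)))

  add-disjoint : ∀ 𝒮 P → AllPairs Disjoint 𝒮 → (∀ x → x ∈ vs P → ¬ Junction 𝒮 x) →
    AllPairs Disjoint (P ∷ 𝒮)
  add-disjoint 𝒮 P dj avoids = All.tabulate (λ Z∈ x x∈P x∈Z → meets-in-y x x∈P (lose Z∈ x∈Z)) ∷ dj
    where
      meets-in-y : ∀ x → x ∈ vs P → OnSystem 𝒮 x → x ≡ y
      meets-in-y x x∈P on with x ≟ y
      ... | yes x≡y = x≡y
      ... | no x≢y = ⊥-elim (avoids x x∈P (x≢y , on))

  module Reroute (𝒮 : List Path) (dj : AllPairs Disjoint 𝒮)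
    {P : Path} (P∈𝒫 : P ∈ paths 𝒫) (P-off : ¬ OnSystem 𝒮 (start P))
    {z : Vertex D} (A : Walk D (start P) z) (BP : Walk D z y) (eqP : walk P ≡ A ++ʷ BP)
    (z≢y : ¬ (z ≡ y)) (z-on : OnSystem 𝒮 z) (before : ∀ x → x ∈ initVertices A → ¬ Junction 𝒮 x) where

    Q : Path
    Q = proj₁ (find z-on)

    Q∈𝒮 : Q ∈ 𝒮
    Q∈𝒮 = proj₁ (proj₂ (find z-on))

    AQ : Walk D (start Q) z
    AQ = proj₁ (splitAt (walk Q) (proj₂ (proj₂ (find z-on))))

    B : Walk D z y
    B = proj₁ (proj₂ (splitAt (walk Q) (proj₂ (proj₂ (find z-on)))))

    eqQ : walk Q ≡ AQ ++ʷ B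
    eqQ = proj₂ (proj₂ (splitAt (walk Q) (proj₂ (proj₂ (find z-on)))))

    vs-P : vs P ≡ initVertices A ++ vertices D BP
    vs-P = trans (cong (vertices D) eqP) (vertices-++ A BP)

    vs-Q : vs Q ≡ initVertices AQ ++ vertices D B
    vs-Q = trans (cong (vertices D) eqQ) (vertices-++ AQ B)

    unique-P : Unique (initVertices A ++ vertices D BP)
    unique-P = subst Unique vs-P (isPath P)

    unique-Q : Unique (initVertices AQ ++ vertices D B)
    unique-Q = subst Unique vs-Q (isPath Q)

    B⊆Q : ∀ {x} → x ∈ vertices D B → x ∈ vs Q
    B⊆Q {x} x∈ = subst (x ∈_) (sym vs-Q) (∈-++⁺ʳ (initVertices AQ) x∈)

    z∈P : z ∈ vs P
    z∈P = subst (z ∈_) (sym vs-P) (∈-++⁺ʳ (initVertices A) (start∈vertices BP))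

    -- the part of P before z avoids 𝒮 (it avoids y since P is a path)
    A-off : ∀ {x} → x ∈ initVertices A → ¬ OnSystem 𝒮 x
    A-off {x} x∈A on = before x x∈A (x≢y , on)
      where
        x≢y : ¬ (x ≡ y)
        x≢y refl = Unique-++-disjoint (initVertices A) unique-P x∈A (end∈vertices BP)

    nonEmpty-A : NonEmpty A
    nonEmpty-A = distinct⇒NonEmpty A (λ start≡z → P-off (subst (OnSystem 𝒮) (sym start≡z) z-on))

    nonEmpty-B : NonEmpty B
    nonEmpty-B = distinct⇒NonEmpty B z≢y

    -- z is an interior vertex of P, hence not in X
    z∉X : z ∉ X
    z∉X = All.lookup (internal P)
      (subst (λ w → z ∈ interior D w) (sym eqP)
        (interior-junction A BP nonEmpty-A (distinct⇒NonEmpty BP z≢y)))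

    nonEmpty-AQ : NonEmpty AQ
    nonEmpty-AQ = distinct⇒NonEmpty AQ (λ start≡z → z∉X (subst (Subset._∈ X) start≡z (start∈X Q)))

    R-walk : Walk D (start P) y
    R-walk = A ++ʷ B

    vs-R : vertices D R-walk ≡ initVertices A ++ vertices D B
    vs-R = vertices-++ A B

    R-isPath : IsPath D R-walk
    R-isPath = subst Unique (sym vs-R)
      (Unique.++⁺ (Unique-++⁻ˡ (initVertices A) unique-P) (Unique-++⁻ʳ (initVertices AQ) unique-Q)
        (λ (x∈A , x∈B) → A-off x∈A (lose Q∈𝒮 (B⊆Q x∈B))))

    R-internal : ∀ {x} → x ∈ interior D R-walk → x ∉ X
    R-internal x∈ with interior-++⁻ A B nonEmpty-A nonEmpty-B x∈
    ... | inj₁ x∈A = All.lookup (internal P)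
                       (subst (λ w → _ ∈ interior D w) (sym eqP) (interior-++ˡ A BP x∈A))
    ... | inj₂ (inj₁ refl) = z∉X
    ... | inj₂ (inj₂ x∈B) = All.lookup (internal Q)
                              (subst (λ w → _ ∈ interior D w) (sym eqQ) (interior-++ʳ AQ B x∈B))

    R : Path
    R = xypath (start P) (start∈X P) R-walk R-isPath (All.tabulate R-internal)

    R-vertices : ∀ {x} → x ∈ vs R → x ∈ initVertices A ⊎ x ∈ vertices D B
    R-vertices {x} x∈ = ∈-++⁻ (initVertices A) (subst (x ∈_) vs-R x∈)

    disjoint-right : ∀ {Z} → Z ∈ 𝒮 → Disjoint Q Z → Disjoint R Z
    disjoint-right Z∈ d x x∈R x∈Z with R-vertices x∈R
    ... | inj₁ x∈A = ⊥-elim (A-off x∈A (lose Z∈ x∈Z))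
    ... | inj₂ x∈B = d x (B⊆Q x∈B) x∈Z

    disjoint-left : ∀ {Z} → Z ∈ 𝒮 → Disjoint Z Q → Disjoint Z R
    disjoint-left Z∈ d x x∈Z x∈R with R-vertices x∈R
    ... | inj₁ x∈A = ⊥-elim (A-off x∈A (lose Z∈ x∈Z))
    ... | inj₂ x∈B = d x x∈Z (B⊆Q x∈B)

    rerouted-disjoint : AllPairs Disjoint (replace 𝒮 Q∈𝒮 R)
    rerouted-disjoint = AllPairs-replace dj Q∈𝒮 disjoint-right disjoint-left

    rerouted-lastEdges : map lastEdgeOf (replace 𝒮 Q∈𝒮 R) ≡ map lastEdgeOf 𝒮
    rerouted-lastEdges = map-replace lastEdgeOf Q∈𝒮
      (trans (lastEdge-++ A B nonEmpty-B) (sym (trans (cong (lastEdge D) eqQ) (lastEdge-++ AQ B nonEmpty-B))))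

    -- Excess.  With rest the vertices of B after z,
    --   vs R = initVertices A ++ z ∷ rest,   vs Q = initVertices AQ ++ z ∷ rest,
    -- and vs P = initVertices A ++ z ∷ _ .
    rest : List (Vertex D)
    rest = proj₁ (vertices-head B)

    -- R shares its initial segment up to z with P
    excess-R : excessOf R ≤ length rest
    excess-R = subst (λ xs → excess xs ≤ length rest) (sym vs-R′)
      (excess-after (initVertices A) z rest
        (≤-trans (subst (λ ws → suc (length (initVertices A)) ≤ commonPrefix (initVertices A ++ z ∷ rest) ws)
                        (sym vs-P′) (commonPrefix-++ (initVertices A) z rest _))
                 (sharedWith-≥ (paths 𝒫) P∈𝒫)))
      where
        vs-R′ : vs R ≡ initVertices A ++ z ∷ rest
        vs-R′ = trans vs-R (cong (initVertices A ++_) (proj₂ (vertices-head B)))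
        vs-P′ : vs P ≡ initVertices A ++ z ∷ proj₁ (vertices-head BP)
        vs-P′ = trans vs-P (cong (initVertices A ++_) (proj₂ (vertices-head BP)))

    -- No 𝒫-path extends Q's initial segment up to z: it would contain z ≠ y,
    -- hence be P, and then Q would start at the uncovered start of P.
    Q-not-extended : ∀ {P′} → P′ ∈ paths 𝒫 → ∀ ws → ¬ (vs P′ ≡ initVertices AQ ++ z ∷ ws)
    Q-not-extended {P′} P′∈ ws eq with AllPairs-lookup (disjoint 𝒫) P∈𝒫 P′∈
    ... | inj₁ refl = P-off (subst (OnSystem 𝒮) startQ≡startP (lose Q∈𝒮 (start∈vertices (walk Q))))
      where
        startQ≡startP : start Q ≡ start P
        startQ≡startP with initVertices-head AQ nonEmpty-AQ | vertices-head (walk P)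
        ... | _ , eqAQ | _ , eqP′ rewrite eqAQ = sym (∷-injectiveˡ (trans (sym eqP′) eq))
    ... | inj₂ (inj₁ d) = z≢y (d z z∈P (subst (z ∈_) (sym eq) (∈-++⁺ʳ (initVertices AQ) (here refl))))
    ... | inj₂ (inj₂ d) = z≢y (d z (subst (z ∈_) (sym eq) (∈-++⁺ʳ (initVertices AQ) (here refl))) z∈P)

    excess-Q : suc (length rest) ≤ excessOf Q
    excess-Q = subst (λ xs → suc (length rest) ≤ excess xs) (sym vs-Q′)
      (excess-before (initVertices AQ) z rest (sharedWith-≤ (paths 𝒫) shares-less))
      where
        vs-Q′ : vs Q ≡ initVertices AQ ++ z ∷ rest
        vs-Q′ = trans vs-Q (cong (initVertices AQ ++_) (proj₂ (vertices-head B)))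
        shares-less : ∀ {P′} → P′ ∈ paths 𝒫 →
          commonPrefix (initVertices AQ ++ z ∷ rest) (vs P′) ≤ length (initVertices AQ)
        shares-less {P′} P′∈ with commonPrefix-≤-or-extends (initVertices AQ) z rest (vs P′)
        ... | inj₁ le = le
        ... | inj₂ (ws , eq) = ⊥-elim (Q-not-extended P′∈ ws eq)

    rerouted-measure : measure (replace 𝒮 Q∈𝒮 R) < measure 𝒮
    rerouted-measure = measure-replace-< 𝒮 Q∈𝒮 (<-≤-trans (s≤s excess-R) excess-Q)

  Improvement : List Path → Set
  Improvement 𝒮 = Σ (List Path) λ 𝒮′ →
    AllPairs Disjoint 𝒮′ × (∀ e → just e ∈ map lastEdgeOf 𝒮 → just e ∈ map lastEdgeOf 𝒮′) ×
    measure 𝒮′ < measure 𝒮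

  improve : ∀ 𝒮 → AllPairs Disjoint 𝒮 → ∀ {P} → P ∈ paths 𝒫 → ¬ OnSystem 𝒮 (start P) → Improvement 𝒮
  improve 𝒮 dj {P} P∈𝒫 P-off with firstHit (junction? 𝒮) (walk P)
  ... | inj₁ avoids = P ∷ 𝒮 , add-disjoint 𝒮 P dj avoids , (λ e → there) , measure-add-< 𝒮 P∈𝒫 P-off
  ... | inj₂ (z , A , BP , eqP , (z≢y , z-on) , before) =
    replace 𝒮 Q∈𝒮 R , rerouted-disjoint ,
    (λ e e∈ → subst (just e ∈_) (sym rerouted-lastEdges) e∈) , rerouted-measure
    where open Reroute 𝒮 dj P∈𝒫 P-off A BP eqP z≢y z-on before

  findUncovered : ∀ 𝒮 Ps →
    Σ Path (λ P → P ∈ Ps × ¬ OnSystem 𝒮 (start P)) ⊎ (∀ {P} → P ∈ Ps → OnSystem 𝒮 (start P))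
  findUncovered 𝒮 [] = inj₂ λ ()
  findUncovered 𝒮 (P ∷ Ps) with onSystem? 𝒮 (start P)
  ... | no off = inj₁ (P , here refl , off)
  ... | yes on with findUncovered 𝒮 Ps
  ...   | inj₁ (P′ , P′∈ , off) = inj₁ (P′ , there P′∈ , off)
  ...   | inj₂ covered = inj₂ λ { (here refl) → on ; (there P′∈) → covered P′∈ }

  Covering : Set
  Covering = Σ (List Path) λ 𝒮 →
    AllPairs Disjoint 𝒮 × KeepsLastEdges 𝒮 × (∀ {P} → P ∈ paths 𝒫 → OnSystem 𝒮 (start P))

  -- iterate the improvement step; the measure bounds the number of steps
  augment : ∀ fuel 𝒮 → AllPairs Disjoint 𝒮 → KeepsLastEdges 𝒮 → measure 𝒮 < fuel → Covering
  augment (suc fuel) 𝒮 dj keeps bound with findUncovered 𝒮 (paths 𝒫)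
  ... | inj₂ covered = 𝒮 , dj , keeps , covered
  ... | inj₁ (P , P∈𝒫 , P-off) with improve 𝒮 dj P∈𝒫 P-off
  ...   | 𝒮′ , dj′ , keeps′ , smaller =
          augment fuel 𝒮′ dj′ (λ e e∈ → keeps′ e (keeps e e∈)) (<-≤-trans smaller (≤-pred bound))

  covering : Covering
  covering = augment (suc (measure (paths 𝒬))) (paths 𝒬) (disjoint 𝒬) (λ e e∈ → e∈) ≤-refl

  covered⇒starts : ∀ 𝒮 → (∀ {P} → P ∈ paths 𝒫 → OnSystem 𝒮 (start P)) →
    ∀ v → v ∈ map start (paths 𝒫) → v ∈ map start 𝒮
  covered⇒starts 𝒮 covered v v∈ with ∈-map⁻ start v∈
  ... | P , P∈ , refl with find (covered P∈)
  ...   | Q , Q∈ , v∈Q = subst (_∈ map start 𝒮) (sym (X-vertex-is-start Q v∈Q (start∈X P))) (∈-map⁺ start Q∈)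

corollary2p3 : (D : Digraph) (X : Subset (Digraph.n D)) (y : Vertex D) → y ∉ X →
    (𝒫 𝒬 : PathSystem D X y) →
    Σ (PathSystem D X y) (λ ℛ →
      (∀ v → _∈V⁻_ D v 𝒫 → _∈V⁻_ D v ℛ) ×
      (∀ e → _∈E⁺_ D e 𝒬 → _∈E⁺_ D e ℛ))
corollary2p3 D X y y∉X 𝒫 𝒬 =
  let open Augmentation D X y y∉X 𝒫 𝒬
      (𝒮 , disjoint-𝒮 , keeps-last-edges , covers-𝒫-starts) = covering
  in pathSystem 𝒮 disjoint-𝒮 , covered⇒starts 𝒮 covers-𝒫-starts , keeps-last-edges
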